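{- Let $n_1\ge 2$ be an integer. (i) For any integer $n_2\ge 4$ with $n_1-1<\lfloor n_2/2\rfloor$, $\dim(P_{n_1}\boxtimes C_{n_2})\le n_2$. (ii) Let $k\ge 2$ be an integer. For any self $k$-resolved graph $H$ of order $n_2$, $\dim(K_{n_1}\boxtimes H)\le (n_1-1)n_2$.
   Context: $P_n$, $C_n$, $K_n$ denote the path, cycle and complete graph of order $n$. All graphs are simple and connected; $d_G$ is the shortest-path distance. A set $S\subseteq V(G)$ is a metric generator for $G$ if for every two distinct vertices $x,y$ there is $s\in S$ with $d_G(s,x)\ne d_G(s,y)$; $\dim(G)$ is the minimum cardinality of a metric generator. The strong product $G\boxtimes H$ has vertex set $V(G)\times V(H)$, with $(a,b)$ and $(c,d)$ adjacent iff ($a=c$ and $bd\in E(H)$) or ($b=d$ and $ac\in E(G)$) or ($ac\in E(G)$ and $bd\in E(H)$). The interval $I[x,y]$ is the set of vertices on some shortest $x$–$y$ path. A connected graph $H$ is self $k$-resolved if for every two distinct vertices $x,y$ there is $w$ with either $d_H(y,w)\ge k$ and $x\in I[y,w]$, or $d_H(x,w)\ge k$ and $y\in I[x,w]$. -}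

module Defs where

open import Data.Nat using (ℕ; zero; suc; _≤_)
open import Data.Fin using (Fin; toℕ)
open import Data.Product using (_×_; Σ; ∃; ∃-syntax; _,_)
open import Data.Sum using (_⊎_)
open import Data.List using (List; length)
open import Data.List.Membership.Propositional using (_∈_)
open import Relation.Binary.PropositionalEquality using (_≡_; _≢_)
open import Relation.Nullary using (¬_)

record Graph (V : Set) : Set₁ where
  field
    Adj : V → V → Set
open Graph public

IsSimple : {V : Set} → Graph V → Set
IsSimple {V} G = (∀ (x y : V) → Adj G x y → Adj G y x) × (∀ (x : V) → ¬ Adj G x x)

data Walk {V : Set} (G : Graph V) : V → V → ℕ → Set where
  here : ∀ x → Walk G x x zero
  step : ∀ {x y z n} → Adj G x y → Walk G y z n → Walk G x z (suc n)

data _∈W_ {V : Set} {G : Graph V} (v : V) : ∀ {x y n} → Walk G x y n → Set where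
  atEnd   : v ∈W here {G = G} v
  atStart : ∀ {y z n} (a : Adj G v y) (w : Walk G y z n) → v ∈W step a w
  later   : ∀ {x y z n} (a : Adj G x y) (w : Walk G y z n) → v ∈W w → v ∈W step a w

Connected : {V : Set} → Graph V → Set
Connected {V} G = ∀ (x y : V) → ∃[ d ] Walk G x y d

Dist : {V : Set} → Graph V → V → V → ℕ → Set
Dist G x y d = Walk G x y d × (∀ m → Walk G x y m → d ≤ m)

InInterval : {V : Set} → Graph V → V → V → V → Set
InInterval G v x y = ∃[ d ] (Dist G x y d × Σ (Walk G x y d) (λ p → v ∈W p))

IsMetricGenerator : {V : Set} → Graph V → List V → Set
IsMetricGenerator {V} G S =
  ∀ (x y : V) → x ≢ y →
    ∃[ s ] (s ∈ S × ∃[ d₁ ] ∃[ d₂ ] (Dist G s x d₁ × Dist G s y d₂ × d₁ ≢ d₂))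

DimLe : {V : Set} → Graph V → ℕ → Set
DimLe {V} G m = ∃[ S ] (length S ≤ m × IsMetricGenerator G S)

SelfResolved : {V : Set} → ℕ → Graph V → Set
SelfResolved {V} k H =
  ∀ (x y : V) → x ≢ y → ∃[ w ]
    ((∃[ d ] (Dist H y w d × k ≤ d) × InInterval H x y w)
     ⊎ (∃[ d ] (Dist H x w d × k ≤ d) × InInterval H y x w))

P : (n : ℕ) → Graph (Fin n)
P n = record { Adj = λ i j → (suc (toℕ i) ≡ toℕ j) ⊎ (suc (toℕ j) ≡ toℕ i) }

C : (n : ℕ) → Graph (Fin n)
C n = record { Adj = λ i j → (suc (toℕ i) ≡ toℕ j) ⊎ (suc (toℕ j) ≡ toℕ i)
                             ⊎ (toℕ i ≡ 0 × suc (toℕ j) ≡ n)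
                             ⊎ (toℕ j ≡ 0 × suc (toℕ i) ≡ n) }

K : (n : ℕ) → Graph (Fin n)
K n = record { Adj = λ i j → i ≢ j }

_⊠_ : {A B : Set} → Graph A → Graph B → Graph (A × B)
G ⊠ H = record { Adj = λ { (a , b) (c , d) →
  (a ≡ c × Adj H b d) ⊎ (b ≡ d × Adj G a c) ⊎ (Adj G a c × Adj H b d) } }

-- Distances in a strong product are the maxima of the distances in the factors, and
-- distances are certified by labellings: a function on the vertices that vanishes only at s,
-- is 1-Lipschitz along edges, and drops along some edge at every other vertex is d(s, ·).
--
-- In P_{n₁} ⊠ C_{n₂} the column vertex (0, j) is at distance max(a, d_C(j, b)) from (a, b).
-- Vertices in rows a < c are resolved by (0, b).  Vertices (a, b), (a, d) in one row are
-- resolved by any j such that exactly one of b, d is within cycle distance a of j; such a j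
-- exists because a + 1 ≤ ⌊n₂/2⌋, so one can go to distance a + 1 from b or d past the other.
--
-- In K_{n₁} ⊠ H the vertices outside the last copy of H resolve.  Two vertices of one copy
-- are at distances 0 and 1 from one of them.  For b ≠ d, self-resolvedness gives w with, say,
-- b ∈ I[d, w] and d_H(d, w) ≥ 2; then d_H(w, b) < d_H(w, d), and since distances in K are at
-- most 1, (e, w) is closer to (a, b) than to (c, d).

module Submission where

open import Defs
open import Data.Nat using (ℕ; zero; suc; _≤_; _<_; _∸_; _*_; _/_; _+_; _⊔_; _⊓_; z≤n; s≤s; s≤s⁻¹; z<s; _≤?_; _<?_)
open import Data.Nat.Properties
open import Data.Nat.DivMod using (m/n*n≤m)
open import Data.Fin using (Fin; zero; suc; toℕ; inject₁; lower₁; fromℕ; fromℕ<) renaming (_≟_ to _≟ᶠ_)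
open import Data.Fin.Properties using (toℕ-injective; toℕ-inject₁; toℕ-lower₁; toℕ<n; toℕ-fromℕ; toℕ-fromℕ<; inject₁-lower₁)
open import Data.Product using (_×_; ∃-syntax; _,_; proj₁; proj₂)
open import Data.Sum using (_⊎_; inj₁; inj₂)
open import Function using (id)
open import Relation.Binary.PropositionalEquality
open import Data.List using (List; []; _∷_; _++_; map; allFin; length; cartesianProduct)
open import Data.List.Properties using (length-++; length-map; length-tabulate)
open import Data.List.Membership.Propositional using (_∈_)
open import Data.List.Membership.Propositional.Properties using (∈-map⁺; ∈-allFin; ∈-cartesianProduct⁺)
open import Relation.Nullary using (yes; no; contradiction)
open import Relation.Binary.Definitions using (tri<; tri≈; tri>)

module _ {V : Set} {G : Graph V} where

  Walk-0⇒≡ : ∀ {x y} → Walk G x y 0 → x ≡ y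
  Walk-0⇒≡ (here _) = refl

  _++ʷ_ : ∀ {x y z m n} → Walk G x y m → Walk G y z n → Walk G x z (m + n)
  here _   ++ʷ w = w
  step a v ++ʷ w = step a (v ++ʷ w)

  _▷_ : ∀ {x y z m} → Walk G x y m → Adj G y z → Walk G x z (suc m)
  here _   ▷ a = step a (here _)
  step b w ▷ a = step b (w ▷ a)

  splitʷ : ∀ {v x y n} (w : Walk G x y n) → v ∈W w →
           ∃[ i ] ∃[ j ] (i + j ≡ n × Walk G x v i × Walk G v y j)
  splitʷ (here _)   atEnd            = 0 , 0 , refl , here _ , here _
  splitʷ (step a w) (atStart .a .w)  = 0 , _ , refl , here _ , step a w
  splitʷ (step a w) (later .a .w v∈w) with splitʷ w v∈w
  ... | i , j , i+j≡n , w₁ , w₂ = suc i , j , cong suc i+j≡n , step a w₁ , w₂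

  Dist-refl : ∀ {x} → Dist G x x 0
  Dist-refl = here _ , λ _ _ → z≤n

  Dist-unique : ∀ {x y d d′} → Dist G x y d → Dist G x y d′ → d ≡ d′
  Dist-unique (w , min) (w′ , min′) = ≤-antisym (min _ w′) (min′ _ w)

  Dist-suffix : ∀ {x v y i j D} → Dist G x y D → Walk G x v i → Walk G v y j → i + j ≡ D →
                Dist G v y j
  Dist-suffix {i = i} {j} (_ , min) w₁ w₂ i+j≡D =
    w₂ , λ m w → +-cancelˡ-≤ i j m (subst (_≤ i + m) (sym i+j≡D) (min _ (w₁ ++ʷ w)))

  module _ (Adj-sym : ∀ {x y} → Adj G x y → Adj G y x) where

    reverseʷ : ∀ {x y m} → Walk G x y m → Walk G y x m
    reverseʷ (here x) = here x
    reverseʷ (step a w) = reverseʷ w ▷ Adj-sym a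

    Dist-sym : ∀ {x y d} → Dist G x y d → Dist G y x d
    Dist-sym (w , min) = reverseʷ w , λ m w′ → min m (reverseʷ w′)

record DistanceLabelling {V : Set} (G : Graph V) (s : V) : Set where
  field
    ℓ                : V → ℕ
    ℓ-source         : ℓ s ≡ 0
    ℓ≡0⇒source       : ∀ {u} → ℓ u ≡ 0 → u ≡ s
    ℓ-lipschitz      : ∀ {u v} → Adj G u v → ℓ v ≤ suc (ℓ u)
    ℓ-predecessor    : ∀ {u n} → ℓ u ≡ suc n → ∃[ v ] (Adj G v u × ℓ v ≤ n)

module _ {V : Set} {G : Graph V} {s : V} (L : DistanceLabelling G s) where
  open DistanceLabelling L

  ℓ≤ℓ+length : ∀ {x u m} → Walk G x u m → ℓ u ≤ ℓ x + m
  ℓ≤ℓ+length (here _) = m≤m+n _ 0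
  ℓ≤ℓ+length {x} (step {n = m} a w) = begin
    ℓ _            ≤⟨ ℓ≤ℓ+length w ⟩
    ℓ _ + m        ≤⟨ +-monoˡ-≤ m (ℓ-lipschitz a) ⟩
    suc (ℓ x + m)  ≡⟨ +-suc (ℓ x) m ⟨
    ℓ x + suc m    ∎
    where open ≤-Reasoning

  walk-of-ℓ : ∀ k {u} → ℓ u ≡ k → Walk G s u k
  walk-of-ℓ zero    ℓu≡0 = subst (λ u → Walk G s u 0) (sym (ℓ≡0⇒source ℓu≡0)) (here s)
  walk-of-ℓ (suc k) {u} ℓu≡1+k with ℓ-predecessor ℓu≡1+k
  ... | v , v~u , ℓv≤k = walk-of-ℓ k ℓv≡k ▷ v~u
    where
    ℓv≡k : ℓ v ≡ k
    ℓv≡k = ≤-antisym ℓv≤k (s≤s⁻¹ (subst (_≤ suc (ℓ v)) ℓu≡1+k (ℓ-lipschitz v~u)))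

  labelling⇒Dist : ∀ u → Dist G s u (ℓ u)
  labelling⇒Dist u = walk-of-ℓ (ℓ u) refl , λ m w → subst (λ k → ℓ u ≤ k + m) ℓ-source (ℓ≤ℓ+length w)

module _ {A B : Set} {G : Graph A} {H : Graph B} where

  ⊠-walkˡ : ∀ {a b c p} → Walk G a c p → Walk (G ⊠ H) (a , b) (c , b) p
  ⊠-walkˡ (here _)   = here _
  ⊠-walkˡ (step g v) = step (inj₂ (inj₁ (refl , g))) (⊠-walkˡ v)

  ⊠-walkʳ : ∀ {a b d q} → Walk H b d q → Walk (G ⊠ H) (a , b) (a , d) q
  ⊠-walkʳ (here _)   = here _
  ⊠-walkʳ (step h w) = step (inj₁ (refl , h)) (⊠-walkʳ w)

  ⊠-walk : ∀ {a b c d p q} → Walk G a c p → Walk H b d q → Walk (G ⊠ H) (a , b) (c , d) (p ⊔ q)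
  ⊠-walk (here _)   w          = ⊠-walkʳ w
  ⊠-walk (step g v) (here _)   = ⊠-walkˡ (step g v)
  ⊠-walk (step g v) (step h w) = step (inj₂ (inj₂ (g , h))) (⊠-walk v w)

contract-walk : ∀ {A B : Set} {G : Graph A} {H : Graph B} (f : A → B) →
  (∀ {u v} → Adj G u v → f u ≡ f v ⊎ Adj H (f u) (f v)) →
  ∀ {x y m} → Walk G x y m → ∃[ p ] (p ≤ m × Walk H (f x) (f y) p)
contract-walk f f-contracts (here _) = 0 , z≤n , here _
contract-walk {H = H} f f-contracts (step a w) with contract-walk f f-contracts w | f-contracts a
... | p , p≤m , w′ | inj₁ fu≡fv = p , m≤n⇒m≤1+n p≤m , subst (λ z → Walk H z (f _) p) (sym fu≡fv) w′
... | p , p≤m , w′ | inj₂ a′    = suc p , s≤s p≤m , step a′ w′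

module _ {A B : Set} {G : Graph A} {H : Graph B} where

  proj₁-contracts : ∀ {u v} → Adj (G ⊠ H) u v → proj₁ u ≡ proj₁ v ⊎ Adj G (proj₁ u) (proj₁ v)
  proj₁-contracts (inj₁ (a≡c , _))         = inj₁ a≡c
  proj₁-contracts (inj₂ (inj₁ (_ , g)))    = inj₂ g
  proj₁-contracts (inj₂ (inj₂ (g , _)))    = inj₂ g

  proj₂-contracts : ∀ {u v} → Adj (G ⊠ H) u v → proj₂ u ≡ proj₂ v ⊎ Adj H (proj₂ u) (proj₂ v)
  proj₂-contracts (inj₁ (_ , h))           = inj₂ h
  proj₂-contracts (inj₂ (inj₁ (b≡d , _)))  = inj₁ b≡d
  proj₂-contracts (inj₂ (inj₂ (_ , h)))    = inj₂ h

  Dist-⊠ : ∀ {a b c d p q} → Dist G a c p → Dist H b d q → Dist (G ⊠ H) (a , b) (c , d) (p ⊔ q)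
  Dist-⊠ (v , minG) (w , minH) = ⊠-walk v w , λ m u →
    let (p′ , p′≤m , v′) = contract-walk proj₁ proj₁-contracts u
        (q′ , q′≤m , w′) = contract-walk proj₂ proj₂-contracts u
    in ⊔-lub (≤-trans (minG p′ v′) p′≤m) (≤-trans (minH q′ w′) q′≤m)

path-labelling : ∀ n → DistanceLabelling (P (suc n)) zero
path-labelling n = record
  { ℓ             = toℕ
  ; ℓ-source      = refl
  ; ℓ≡0⇒source    = toℕ-injective
  ; ℓ-lipschitz   = lipschitz
  ; ℓ-predecessor = predecessor
  }
  where
  lipschitz : ∀ {u v} → Adj (P (suc n)) u v → toℕ v ≤ suc (toℕ u)
  lipschitz (inj₁ 1+u≡v) = ≤-reflexive (sym 1+u≡v)
  lipschitz (inj₂ 1+v≡u) = m≤n⇒m≤1+n (≤-trans (n≤1+n _) (≤-reflexive 1+v≡u))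

  predecessor : ∀ {u k} → toℕ u ≡ suc k → ∃[ v ] (Adj (P (suc n)) v u × toℕ v ≤ k)
  predecessor {suc i} i≡k = inject₁ i , inj₁ (cong suc (toℕ-inject₁ i)) ,
                            ≤-reflexive (trans (toℕ-inject₁ i) (suc-injective i≡k))

fwd : ℕ → ℕ → ℕ → ℕ
fwd N x y with x ≤? y
... | yes _ = y ∸ x
... | no  _ = N + y ∸ x

cycleDist : ℕ → ℕ → ℕ → ℕ
cycleDist N x y = fwd N x y ⊓ fwd N y x

module _ {N : ℕ} where

  fwd-≤ : ∀ {x y} → x ≤ y → fwd N x y ≡ y ∸ x
  fwd-≤ {x} {y} x≤y with x ≤? y
  ... | yes _   = refl
  ... | no  x≰y = contradiction x≤y x≰y

  fwd-> : ∀ {x y} → y < x → fwd N x y ≡ N + y ∸ x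
  fwd-> {x} {y} y<x with x ≤? y
  ... | yes x≤y = contradiction x≤y (<⇒≱ y<x)
  ... | no  _   = refl

  fwd-self : ∀ x → fwd N x x ≡ 0
  fwd-self x = trans (fwd-≤ (≤-refl {x})) (n∸n≡0 x)

  fwd≡0⇒≡ : ∀ {x y} → x < N → fwd N x y ≡ 0 → x ≡ y
  fwd≡0⇒≡ {x} {y} x<N fwd≡0 with x ≤? y
  ... | yes x≤y = ≤-antisym x≤y (m∸n≡0⇒m≤n fwd≡0)
  ... | no  _   = contradiction (≤-trans (m≤m+n N y) (m∸n≡0⇒m≤n fwd≡0)) (<⇒≱ x<N)

  cycleDist-self : ∀ x → cycleDist N x x ≡ 0
  cycleDist-self x = cong (λ k → k ⊓ k) (fwd-self x)

  cycleDist-comm : ∀ x y → cycleDist N x y ≡ cycleDist N y x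
  cycleDist-comm x y = ⊓-comm (fwd N x y) (fwd N y x)

  cycleDist-+ : ∀ x e → cycleDist N x (x + e) ≡ e ⊓ (N ∸ e)
  cycleDist-+ x zero rewrite +-identityʳ x = cycleDist-self x
  cycleDist-+ x e@(suc _) = cong₂ _⊓_ forward backward
    where
    forward : fwd N x (x + e) ≡ e
    forward = trans (fwd-≤ (m≤m+n x e)) (m+n∸m≡n x e)
    backward : fwd N (x + e) x ≡ N ∸ e
    backward = begin
      fwd N (x + e) x   ≡⟨ fwd-> (m<m+n x z<s) ⟩
      N + x ∸ (x + e)   ≡⟨ cong (_∸ (x + e)) (+-comm N x) ⟩
      x + N ∸ (x + e)   ≡⟨ [m+n]∸[m+o]≡n∸o x N e ⟩
      N ∸ e             ∎
      where open ≡-Reasoning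

next : ∀ {N} → Fin N → Fin N
next {suc n} i with toℕ i ≟ n
... | yes _   = zero
... | no  i≢n = suc (lower₁ i (λ n≡i → i≢n (sym n≡i)))

next-cases : ∀ {N} (i : Fin N) → (suc (toℕ i) ≡ N × toℕ (next i) ≡ 0)
                              ⊎ (suc (toℕ i) < N × toℕ (next i) ≡ suc (toℕ i))
next-cases {suc n} i with toℕ i ≟ n
... | yes i≡n = inj₁ (cong suc i≡n , refl)
... | no  i≢n = inj₂ (s≤s (≤∧≢⇒< (s≤s⁻¹ (toℕ<n i)) i≢n) , cong suc (toℕ-lower₁ i _))

next-surjective : ∀ {N} (u : Fin N) → ∃[ v ] next v ≡ u
next-surjective {suc n} zero with next-cases (fromℕ n)
... | inj₁ (_ , next≡0)   = fromℕ n , toℕ-injective next≡0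
... | inj₂ (n<n , _)      = contradiction (subst (λ k → suc k < suc n) (toℕ-fromℕ n) n<n) (<-irrefl refl)
next-surjective {suc n} (suc i) with next-cases (inject₁ i)
... | inj₁ (1+i≡1+n , _)  = contradiction (trans (sym (toℕ-inject₁ i)) (suc-injective 1+i≡1+n)) (<⇒≢ (toℕ<n i))
... | inj₂ (_ , next≡1+i) = inject₁ i , toℕ-injective (trans next≡1+i (cong suc (toℕ-inject₁ i)))

module _ {N : ℕ} where

  C-sym : ∀ {u v : Fin N} → Adj (C N) u v → Adj (C N) v u
  C-sym (inj₁ e)                = inj₂ (inj₁ e)
  C-sym (inj₂ (inj₁ e))         = inj₁ e
  C-sym (inj₂ (inj₂ (inj₁ p)))  = inj₂ (inj₂ (inj₂ p))
  C-sym (inj₂ (inj₂ (inj₂ p)))  = inj₂ (inj₂ (inj₁ p))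

  Adj-next : (u : Fin N) → Adj (C N) u (next u)
  Adj-next u with next-cases u
  ... | inj₁ (1+u≡N , next≡0)  = inj₂ (inj₂ (inj₂ (next≡0 , 1+u≡N)))
  ... | inj₂ (_ , next≡1+u)    = inj₁ (sym next≡1+u)

  ≡next : ∀ {u v : Fin N} → suc (toℕ u) ≡ toℕ v → v ≡ next u
  ≡next {u} {v} 1+u≡v with next-cases u
  ... | inj₁ (1+u≡N , _)    = contradiction (trans (sym 1+u≡v) 1+u≡N) (<⇒≢ (toℕ<n v))
  ... | inj₂ (_ , next≡1+u) = toℕ-injective (trans (sym 1+u≡v) (sym next≡1+u))

  ≡next-wrap : ∀ {u v : Fin N} → toℕ v ≡ 0 → suc (toℕ u) ≡ N → v ≡ next u
  ≡next-wrap {u} v≡0 1+u≡N with next-cases u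
  ... | inj₁ (_ , next≡0)  = toℕ-injective (trans v≡0 (sym next≡0))
  ... | inj₂ (1+u<N , _)   = contradiction 1+u≡N (<⇒≢ 1+u<N)

  Adj⇒next : ∀ {u v : Fin N} → Adj (C N) u v → v ≡ next u ⊎ u ≡ next v
  Adj⇒next (inj₁ 1+u≡v)                      = inj₁ (≡next 1+u≡v)
  Adj⇒next (inj₂ (inj₁ 1+v≡u))               = inj₂ (≡next 1+v≡u)
  Adj⇒next (inj₂ (inj₂ (inj₁ (u≡0 , 1+v≡N)))) = inj₂ (≡next-wrap u≡0 1+v≡N)
  Adj⇒next (inj₂ (inj₂ (inj₂ (v≡0 , 1+u≡N)))) = inj₁ (≡next-wrap v≡0 1+u≡N)

  fwd-next-source : ∀ {u s : Fin N} → u ≢ s →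
             fwd N (toℕ u) (toℕ s) ≡ suc (fwd N (toℕ (next u)) (toℕ s))
  fwd-next-source {u} {s} u≢s with next-cases u | <-cmp (toℕ u) (toℕ s)
  ... | _ | tri≈ _ u≡s _ = contradiction (toℕ-injective u≡s) u≢s
  ... | inj₁ (1+u≡N , _) | tri< u<s _ _ =
    contradiction (subst (toℕ s <_) (sym 1+u≡N) (toℕ<n s)) (<⇒≱ (s≤s u<s))
  ... | inj₁ (1+u≡N , next≡0) | tri> _ _ s<u rewrite next≡0 = begin
    fwd N (toℕ u) (toℕ s)        ≡⟨ fwd-> s<u ⟩
    N + toℕ s ∸ toℕ u            ≡⟨ cong (λ n → n + toℕ s ∸ toℕ u) (sym 1+u≡N) ⟩
    suc (toℕ u + toℕ s) ∸ toℕ u  ≡⟨ cong (_∸ toℕ u) (sym (+-suc (toℕ u) (toℕ s))) ⟩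
    toℕ u + suc (toℕ s) ∸ toℕ u  ≡⟨ m+n∸m≡n (toℕ u) (suc (toℕ s)) ⟩
    suc (toℕ s)                  ≡⟨ cong suc (fwd-≤ {N} z≤n) ⟨
    suc (fwd N 0 (toℕ s))        ∎
    where open ≡-Reasoning
  ... | inj₂ (_ , next≡1+u) | tri< u<s _ _ rewrite next≡1+u =
    trans (fwd-≤ (<⇒≤ u<s)) (trans (+-∸-assoc 1 u<s) (cong suc (sym (fwd-≤ u<s))))
  ... | inj₂ (1+u<N , next≡1+u) | tri> _ _ s<u rewrite next≡1+u =
    trans (fwd-> s<u)
      (trans (+-∸-assoc 1 (≤-trans (<⇒≤ 1+u<N) (m≤m+n N (toℕ s))))
             (cong suc (sym (fwd-> (m≤n⇒m≤1+n s<u)))))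

  fwd-next-target : ∀ {s u : Fin N} → s ≢ next u →
                fwd N (toℕ s) (toℕ (next u)) ≡ suc (fwd N (toℕ s) (toℕ u))
  fwd-next-target {s} {u} s≢next with next-cases u
  ... | inj₁ (1+u≡N , next≡0) rewrite next≡0 = begin
    fwd N (toℕ s) 0           ≡⟨ fwd-> 0<s ⟩
    N + 0 ∸ toℕ s             ≡⟨ cong (_∸ toℕ s) (trans (+-identityʳ N) (sym 1+u≡N)) ⟩
    suc (toℕ u) ∸ toℕ s       ≡⟨ +-∸-assoc 1 s≤u ⟩
    suc (toℕ u ∸ toℕ s)       ≡⟨ cong suc (fwd-≤ s≤u) ⟨
    suc (fwd N (toℕ s) (toℕ u)) ∎
    where
    open ≡-Reasoning
    0<s : 0 < toℕ s
    0<s = n≢0⇒n>0 (λ s≡0 → s≢next (toℕ-injective (trans s≡0 (sym next≡0))))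
    s≤u : toℕ s ≤ toℕ u
    s≤u = s≤s⁻¹ (subst (toℕ s <_) (sym 1+u≡N) (toℕ<n s))
  ... | inj₂ (1+u<N , next≡1+u) rewrite next≡1+u with ≤-<-connex (toℕ s) (toℕ u)
  ...   | inj₁ s≤u =
    trans (fwd-≤ (m≤n⇒m≤1+n s≤u)) (trans (+-∸-assoc 1 s≤u) (cong suc (sym (fwd-≤ s≤u))))
  ...   | inj₂ u<s = begin
    fwd N (toℕ s) (suc (toℕ u))     ≡⟨ fwd-> 1+u<s ⟩
    N + suc (toℕ u) ∸ toℕ s         ≡⟨ cong (_∸ toℕ s) (+-suc N (toℕ u)) ⟩
    suc (N + toℕ u) ∸ toℕ s         ≡⟨ +-∸-assoc 1 (≤-trans (<⇒≤ (toℕ<n s)) (m≤m+n N (toℕ u))) ⟩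
    suc (N + toℕ u ∸ toℕ s)         ≡⟨ cong suc (fwd-> u<s) ⟨
    suc (fwd N (toℕ s) (toℕ u))     ∎
    where
    open ≡-Reasoning
    1+u<s : suc (toℕ u) < toℕ s
    1+u<s = ≤∧≢⇒< u<s (λ 1+u≡s → s≢next (toℕ-injective (trans (sym 1+u≡s) (sym next≡1+u))))

module _ {N : ℕ} (s : Fin N) where

  private
    fwd-from fwd-to : Fin N → ℕ
    fwd-from u = fwd N (toℕ s) (toℕ u)
    fwd-to   u = fwd N (toℕ u) (toℕ s)

    ℓ : Fin N → ℕ
    ℓ u = cycleDist N (toℕ s) (toℕ u)

    ≡s⇒fwd-from≡fwd-to : ∀ {u} → u ≡ s → fwd-from u ≡ fwd-to u
    ≡s⇒fwd-from≡fwd-to refl = refl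

    ≡s⇒ℓ≡0 : ∀ {u} → u ≡ s → ℓ u ≡ 0
    ≡s⇒ℓ≡0 refl = cycleDist-self (toℕ s)

    ℓ≡0⇒source : ∀ {u} → ℓ u ≡ 0 → u ≡ s
    ℓ≡0⇒source {u} ℓu≡0 with ⊓-sel (fwd-from u) (fwd-to u)
    ... | inj₁ ℓ≡from = sym (toℕ-injective (fwd≡0⇒≡ (toℕ<n s) (trans (sym ℓ≡from) ℓu≡0)))
    ... | inj₂ ℓ≡to   = toℕ-injective (fwd≡0⇒≡ (toℕ<n u) (trans (sym ℓ≡to) ℓu≡0))

    from-next≤ : ∀ u → fwd-from (next u) ≤ suc (fwd-from u)
    from-next≤ u with s ≟ᶠ next u
    ... | yes refl = ≤-trans (≤-reflexive (fwd-self (toℕ s))) z≤n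
    ... | no  s≢nu = ≤-reflexive (fwd-next-target s≢nu)

    to≤next : ∀ u → fwd-to u ≤ suc (fwd-to (next u))
    to≤next u with u ≟ᶠ s
    ... | yes refl = ≤-trans (≤-reflexive (fwd-self (toℕ s))) z≤n
    ... | no  u≢s  = ≤-reflexive (fwd-next-source u≢s)

    ℓ-next≤ : ∀ u → ℓ (next u) ≤ suc (ℓ u)
    ℓ-next≤ u = ⊓-glb (≤-trans (m⊓n≤m _ _) (from-next≤ u)) to-bound
      where
      to-bound : ℓ (next u) ≤ suc (fwd-to u)
      to-bound with u ≟ᶠ s
      ... | yes u≡s = ≤-trans (m⊓n≤m _ _)
                        (subst (λ k → fwd-from (next u) ≤ suc k) (≡s⇒fwd-from≡fwd-to u≡s) (from-next≤ u))
      ... | no  u≢s = ≤-trans (m⊓n≤n _ _)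
                        (m≤n⇒m≤1+n (≤-trans (n≤1+n _) (≤-reflexive (sym (fwd-next-source u≢s)))))

    ℓ≤next : ∀ u → ℓ u ≤ suc (ℓ (next u))
    ℓ≤next u = ⊓-glb from-bound (≤-trans (m⊓n≤n _ _) (to≤next u))
      where
      from-bound : ℓ u ≤ suc (fwd-from (next u))
      from-bound with s ≟ᶠ next u
      ... | yes s≡nu = ≤-trans (m⊓n≤n _ _)
                         (subst (λ k → fwd-to u ≤ suc k) (sym (≡s⇒fwd-from≡fwd-to (sym s≡nu))) (to≤next u))
      ... | no  s≢nu = ≤-trans (m⊓n≤m _ _)
                         (m≤n⇒m≤1+n (≤-trans (n≤1+n _) (≤-reflexive (sym (fwd-next-target s≢nu)))))

    lipschitz : ∀ {u v} → Adj (C N) u v → ℓ v ≤ suc (ℓ u)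
    lipschitz {u} {v} u~v with Adj⇒next u~v
    ... | inj₁ v≡nu = subst (λ w → ℓ w ≤ suc (ℓ u)) (sym v≡nu) (ℓ-next≤ u)
    ... | inj₂ u≡nv = subst (λ w → ℓ v ≤ suc (ℓ w)) (sym u≡nv) (ℓ≤next v)

    predecessor : ∀ {u n} → ℓ u ≡ suc n → ∃[ v ] (Adj (C N) v u × ℓ v ≤ n)
    predecessor {u} {n} ℓu≡1+n with ⊓-sel (fwd-from u) (fwd-to u)
    ... | inj₁ ℓ≡from =
      let (v , nv≡u) = next-surjective u
          s≢nv : s ≢ next v
          s≢nv s≡nv = u≢s (trans (sym nv≡u) (sym s≡nv))
          from-v≡n : fwd-from v ≡ n
          from-v≡n = suc-injective (trans (sym (fwd-next-target s≢nv))
                       (trans (cong fwd-from nv≡u) (trans (sym ℓ≡from) ℓu≡1+n)))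
      in v , subst (Adj (C N) v) nv≡u (Adj-next v) , ≤-trans (m⊓n≤m _ _) (≤-reflexive from-v≡n)
      where
      u≢s : u ≢ s
      u≢s u≡s = 0≢1+n (trans (sym (≡s⇒ℓ≡0 u≡s)) ℓu≡1+n)
    ... | inj₂ ℓ≡to =
      next u , C-sym (Adj-next u) ,
      ≤-trans (m⊓n≤n _ _) (≤-reflexive (suc-injective (trans (sym (fwd-next-source u≢s)) (trans (sym ℓ≡to) ℓu≡1+n))))
      where
      u≢s : u ≢ s
      u≢s u≡s = 0≢1+n (trans (sym (≡s⇒ℓ≡0 u≡s)) ℓu≡1+n)

  cycle-labelling : DistanceLabelling (C N) s
  cycle-labelling = record
    { ℓ             = ℓ
    ; ℓ-source      = cycleDist-self (toℕ s)
    ; ℓ≡0⇒source    = ℓ≡0⇒source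
    ; ℓ-lipschitz   = lipschitz
    ; ℓ-predecessor = predecessor
    }

Separates : ℕ → ℕ → ℕ → ℕ → ℕ → Set
Separates N A j b d = (cycleDist N j b ≤ A × A < cycleDist N j d)
                    ⊎ (cycleDist N j d ≤ A × A < cycleDist N j b)

Separates-sym : ∀ {N A j b d} → Separates N A j b d → Separates N A j d b
Separates-sym (inj₁ p) = inj₂ p
Separates-sym (inj₂ p) = inj₁ p

module _ {N A : ℕ} where

  cycleDist-offset : ∀ {x y e} → x + e ≡ y ⊎ y + e ≡ x → cycleDist N x y ≡ e ⊓ (N ∸ e)
  cycleDist-offset {x}         {e = e} (inj₁ refl) = cycleDist-+ x e
  cycleDist-offset {y = y} {e = e} (inj₂ refl) = trans (cycleDist-comm (y + e) y) (cycleDist-+ y e)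

  cycleDist-near : ∀ {x y e} → x + e ≡ y ⊎ y + e ≡ x → e ≤ A → cycleDist N x y ≤ A
  cycleDist-near offset e≤A = ≤-trans (≤-reflexive (cycleDist-offset offset)) (≤-trans (m⊓n≤m _ _) e≤A)

  cycleDist-far : ∀ {x y e} → x + e ≡ y ⊎ y + e ≡ x → A < e → A + e < N → A < cycleDist N x y
  cycleDist-far {e = e} offset A<e A+e<N =
    subst (A <_) (sym (cycleDist-offset offset)) (⊓-glb A<e (m+n≤o⇒m≤o∸n (suc A) A+e<N))

  module _ (2A+2≤N : suc A + suc A ≤ N) {b d : ℕ} (b<d : b < d) (d<N : d < N) where

    private
      T = d ∸ b

      b+T≡d : b + T ≡ d
      b+T≡d = m+[n∸m]≡n (<⇒≤ b<d)

      b<N : b < N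
      b<N = <-trans b<d d<N

      T<N : T < N
      T<N = ≤-<-trans (m∸n≤m d b) d<N

    separation-far : A < T → A + T < N → Separates N A b b d
    separation-far A<T A+T<N =
      inj₁ (≤-trans (≤-reflexive (cycleDist-self b)) z≤n , cycleDist-far (inj₁ b+T≡d) A<T A+T<N)

    -- Otherwise j is put at cycle distance A + 1 from one of b, d, beyond the other one.
    module _ (T≤A : T ≤ A) where

      private
        r = A ∸ T

        T+r≡A : T + r ≡ A
        T+r≡A = m+[n∸m]≡n T≤A

        1+r≤A : suc r ≤ A
        1+r≤A = subst (suc r ≤_) T+r≡A (+-monoˡ-≤ r (m<n⇒0<n∸m b<d))

      separation-short : ∃[ j ] (j < N × Separates N A j b d)
      separation-short with suc r ≤? b
      ... | yes 1+r≤b = c , ≤-<-trans (m≤m+n c (suc r)) (subst (_< N) (sym c+1+r≡b) b<N) ,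
        inj₁ (cycleDist-near (inj₁ c+1+r≡b) 1+r≤A , cycleDist-far (inj₁ c+1+A≡d) ≤-refl 2A+2≤N)
        where
        open ≡-Reasoning
        c = b ∸ suc r
        c+1+r≡b : c + suc r ≡ b
        c+1+r≡b = m∸n+n≡m 1+r≤b
        c+1+A≡d : c + suc A ≡ d
        c+1+A≡d = begin
          c + suc A        ≡⟨ cong (λ a → c + suc a) (trans (sym T+r≡A) (+-comm T r)) ⟩
          c + suc (r + T)  ≡⟨ +-assoc c (suc r) T ⟨
          c + suc r + T    ≡⟨ cong (_+ T) c+1+r≡b ⟩
          b + T            ≡⟨ b+T≡d ⟩
          d                ∎
      ... | no 1+r≰b = b + suc A , b+1+A<N ,
        inj₂ (cycleDist-near (inj₂ d+1+r≡b+1+A) 1+r≤A ,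
              cycleDist-far {x = b + suc A} {e = suc A} (inj₂ refl) ≤-refl 2A+2≤N)
        where
        open ≡-Reasoning
        d+1+r≡b+1+A : d + suc r ≡ b + suc A
        d+1+r≡b+1+A = begin
          d + suc r          ≡⟨ cong (_+ suc r) b+T≡d ⟨
          b + T + suc r      ≡⟨ +-assoc b T (suc r) ⟩
          b + (T + suc r)    ≡⟨ cong (b +_) (trans (+-suc T r) (cong suc T+r≡A)) ⟩
          b + suc A          ∎
        b+1+A<N : b + suc A < N
        b+1+A<N = ≤-<-trans (+-monoˡ-≤ (suc A) (≤-trans (s≤s⁻¹ (≰⇒> 1+r≰b)) (m∸n≤m A T))) 2A+2≤N
    separation-wrapped : N ≤ A + T → ∃[ j ] (j < N × Separates N A j b d)
    separation-wrapped N≤A+T = b + p , b+p<N ,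
      inj₁ (cycleDist-near {x = b + p} {e = p} (inj₂ refl) p≤A ,
            cycleDist-far (inj₁ b+p+F≡d) 1+A≤F (≤-reflexive 1+A+F≡N))
      where
      F = N ∸ suc A
      1+A+F≡N : suc A + F ≡ N
      1+A+F≡N = m+[n∸m]≡n (≤-trans (m≤m+n (suc A) (suc A)) 2A+2≤N)
      1+A≤F : suc A ≤ F
      1+A≤F = +-cancelˡ-≤ (suc A) (suc A) F (subst (suc A + suc A ≤_) (sym 1+A+F≡N) 2A+2≤N)
      F≤T : F ≤ T
      F≤T = <⇒≤ (+-cancelˡ-≤ A (suc F) T (≤-trans (≤-reflexive (trans (+-suc A F) 1+A+F≡N)) N≤A+T))
      p = T ∸ F
      p+F≡T : p + F ≡ T
      p+F≡T = m∸n+n≡m F≤T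
      b+p+F≡d : b + p + F ≡ d
      b+p+F≡d = trans (+-assoc b p F) (trans (cong (b +_) p+F≡T) b+T≡d)
      p≤A : p ≤ A
      p≤A = s≤s⁻¹ (+-cancelʳ-< F p (suc A) (subst₂ _<_ (sym p+F≡T) (sym 1+A+F≡N) T<N))
      b+p<N : b + p < N
      b+p<N = ≤-<-trans (+-monoʳ-≤ b (m∸n≤m T F)) (subst (_< N) (sym b+T≡d) d<N)

    cycle-separation : ∃[ j ] (j < N × Separates N A j b d)
    cycle-separation with T ≤? A | A + T <? N
    ... | yes T≤A | _         = separation-short T≤A
    ... | no  T≰A | yes A+T<N = b , b<N , separation-far (≰⇒> T≰A) A+T<N
    ... | no  _   | no  A+T≮N = separation-wrapped (≮⇒≥ A+T≮N)

∃<⇒∃ᶠ : ∀ {N} {Q : ℕ → Set} → ∃[ j ] (j < N × Q j) → ∃[ j ] Q (toℕ {N} j)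
∃<⇒∃ᶠ {Q = Q} (j , j<N , q) = fromℕ< j<N , subst Q (sym (toℕ-fromℕ< j<N)) q

cycle-separationᶠ : ∀ {N A} → suc A + suc A ≤ N → {b d : Fin N} → b ≢ d →
                    ∃[ j ] Separates N A (toℕ j) (toℕ b) (toℕ d)
cycle-separationᶠ {N} {A} 2A+2≤N {b} {d} b≢d with <-cmp (toℕ b) (toℕ d)
... | tri≈ _ b≡d _ = contradiction (toℕ-injective b≡d) b≢d
... | tri< b<d _ _ = ∃<⇒∃ᶠ (cycle-separation 2A+2≤N b<d (toℕ<n d))
... | tri> _ _ d<b = let (j , sep) = ∃<⇒∃ᶠ (cycle-separation 2A+2≤N d<b (toℕ<n b))
                     in j , Separates-sym {N} {A} {toℕ j} sep

Resolves : ∀ {V : Set} → Graph V → V → V → V → Set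
Resolves G s x y = ∃[ d₁ ] ∃[ d₂ ] (Dist G s x d₁ × Dist G s y d₂ × d₁ ≢ d₂)

module _ {V : Set} {G : Graph V} {s : V} where

  resolves-by : ∀ {x y d₁ d₂} → Dist G s x d₁ → Dist G s y d₂ → d₁ < d₂ → Resolves G s x y
  resolves-by dx dy d₁<d₂ = _ , _ , dx , dy , <⇒≢ d₁<d₂

  Resolves-sym : ∀ {x y} → Resolves G s x y → Resolves G s y x
  Resolves-sym (d₁ , d₂ , dx , dy , d₁≢d₂) = d₂ , d₁ , dy , dx , λ d₂≡d₁ → d₁≢d₂ (sym d₂≡d₁)

module _ (m N : ℕ) where

  private
    PC = P (suc m) ⊠ C N

  column₀ : List (Fin (suc m) × Fin N)
  column₀ = map (zero ,_) (allFin N)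

  length-column₀ : length column₀ ≡ N
  length-column₀ = trans (length-map (zero ,_) (allFin N)) (length-tabulate {n = N} id)

  private
    ∈-column₀ : (j : Fin N) → (zero , j) ∈ column₀
    ∈-column₀ j = ∈-map⁺ (zero ,_) (∈-allFin j)

    self≤ : ∀ {A} (b : Fin N) → cycleDist N (toℕ b) (toℕ b) ≤ A
    self≤ b = ≤-trans (≤-reflexive (cycleDist-self (toℕ b))) z≤n

  P⊠C-dist : ∀ (a : Fin (suc m)) (b j : Fin N) → Dist PC (zero , j) (a , b) (toℕ a ⊔ cycleDist N (toℕ j) (toℕ b))
  P⊠C-dist a b j = Dist-⊠ (labelling⇒Dist (path-labelling m) a) (labelling⇒Dist (cycle-labelling j) b)

  P⊠C-generator : suc m + suc m ≤ N → IsMetricGenerator PC column₀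
  P⊠C-generator 2m+2≤N (a , b) (c , d) x≢y with <-cmp (toℕ a) (toℕ c)
  ... | tri< a<c _ _ = (zero , b) , ∈-column₀ b ,
    resolves-by (P⊠C-dist a b b) (P⊠C-dist c d b)
      (≤-<-trans (⊔-lub ≤-refl (self≤ b)) (<-≤-trans a<c (m≤m⊔n _ _)))
  ... | tri> _ _ c<a = (zero , d) , ∈-column₀ d , Resolves-sym (
    resolves-by (P⊠C-dist c d d) (P⊠C-dist a b d)
      (≤-<-trans (⊔-lub ≤-refl (self≤ d)) (<-≤-trans c<a (m≤m⊔n _ _))))
  ... | tri≈ _ a≡c _ with cycle-separationᶠ (2A+2≤N a) b≢d
    where
    b≢d : b ≢ d
    b≢d b≡d = x≢y (cong₂ _,_ (toℕ-injective a≡c) b≡d)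
    2A+2≤N : (e : Fin (suc m)) → suc (toℕ e) + suc (toℕ e) ≤ N
    2A+2≤N e = ≤-trans (+-mono-≤ (toℕ<n e) (toℕ<n e)) 2m+2≤N
  ...   | j , inj₁ (near , far) = (zero , j) , ∈-column₀ j ,
    resolves-by (P⊠C-dist a b j) (P⊠C-dist c d j)
      (≤-<-trans (⊔-lub ≤-refl near) (<-≤-trans far (m≤n⊔m _ _)))
  ...   | j , inj₂ (near , far) = (zero , j) , ∈-column₀ j , Resolves-sym (
    resolves-by (P⊠C-dist c d j) (P⊠C-dist a b j)
      (≤-<-trans (⊔-lub (≤-reflexive (sym a≡c)) near) (<-≤-trans far (m≤n⊔m _ _))))

Dist-K≢ : ∀ {n} {e a : Fin n} → e ≢ a → Dist (K n) e a 1
Dist-K≢ e≢a = step e≢a (here _) , λ where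
  zero    w → contradiction (Walk-0⇒≡ w) e≢a
  (suc _) _ → s≤s z≤n

Dist-K : ∀ {n} (e a : Fin n) → ∃[ t ] (t ≤ 1 × Dist (K n) e a t)
Dist-K e a with e ≟ᶠ a
... | yes refl = 0 , z≤n , Dist-refl
... | no  e≢a  = 1 , ≤-refl , Dist-K≢ e≢a

module _ {V : Set} {H : Graph V} (Adj-sym : ∀ {x y} → Adj H x y → Adj H y x) where

  interval-closer : ∀ {b d w D} → b ≢ d → Dist H d w D → InInterval H b d w →
                    ∃[ j ] (j < D × Dist H w b j)
  interval-closer b≢d dist (_ , dist′ , p , b∈p) with splitʷ p b∈p
  ... | zero  , _ , _ , d→b , _ = contradiction (sym (Walk-0⇒≡ d→b)) b≢d
  ... | suc i , j , i+j≡D′ , d→b , b→w =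
    j , subst (j <_) (trans i+j≡D′ (Dist-unique dist′ dist)) (s≤s (m≤n+m j i)) ,
    Dist-sym Adj-sym (Dist-suffix dist′ d→b b→w i+j≡D′)

  resolves-via-interval : ∀ {n b d w D} → 2 ≤ D → Dist H d w D → InInterval H b d w → b ≢ d →
                          ∀ (e a c : Fin n) → Resolves (K n ⊠ H) (e , w) (a , b) (c , d)
  resolves-via-interval 2≤D dist b∈I b≢d e a c =
    let (j , j<D , w→b) = interval-closer b≢d dist b∈I
        (t , t≤1 , e→a) = Dist-K e a
        (t′ , _ , e→c)  = Dist-K e c
    in resolves-by (Dist-⊠ e→a w→b) (Dist-⊠ e→c (Dist-sym Adj-sym dist))
         (<-≤-trans (⊔-lub (<-≤-trans (s≤s t≤1) 2≤D) j<D) (m≤n⊔m t′ _))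

length-cartesianProduct : ∀ {A B : Set} (xs : List A) (ys : List B) →
                          length (cartesianProduct xs ys) ≡ length xs * length ys
length-cartesianProduct []       ys = refl
length-cartesianProduct (x ∷ xs) ys = begin
  length (map (x ,_) ys ++ cartesianProduct xs ys)         ≡⟨ length-++ (map (x ,_) ys) ⟩
  length (map (x ,_) ys) + length (cartesianProduct xs ys) ≡⟨ cong₂ _+_ (length-map (x ,_) ys) (length-cartesianProduct xs ys) ⟩
  length ys + length xs * length ys                        ∎
  where open ≡-Reasoning

module _ (m n : ℕ) where

  fibres-but-last : List (Fin (suc (suc m)) × Fin n)
  fibres-but-last = cartesianProduct (map inject₁ (allFin (suc m))) (allFin n)

  length-fibres-but-last : length fibres-but-last ≡ suc m * n
  length-fibres-but-last = trans (length-cartesianProduct (map inject₁ (allFin (suc m))) (allFin n))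
                      (cong₂ _*_ (trans (length-map inject₁ (allFin (suc m))) (length-tabulate {n = suc m} id))
                                 (length-tabulate {n = n} id))

  ∈-fibres-but-last : (e : Fin (suc (suc m))) → suc m ≢ toℕ e → (h : Fin n) → (e , h) ∈ fibres-but-last
  ∈-fibres-but-last e e≢last h = subst (λ e′ → (e′ , h) ∈ fibres-but-last) (inject₁-lower₁ e e≢last)
                        (∈-cartesianProduct⁺ (∈-map⁺ inject₁ (∈-allFin _)) (∈-allFin h))

  resolves-in-fibre : ∀ {H : Graph (Fin n)} {a c : Fin (suc (suc m))} (b : Fin n) → a ≢ c →
                      ∃[ s ] (s ∈ fibres-but-last × Resolves (K (suc (suc m)) ⊠ H) s (a , b) (c , b))
  resolves-in-fibre {a = a} {c} b a≢c with suc m ≟ toℕ a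
  ... | no  a≢last = (a , b) , ∈-fibres-but-last a a≢last b ,
    resolves-by Dist-refl (Dist-⊠ (Dist-K≢ a≢c) Dist-refl) z<s
  ... | yes a≡last = (c , b) , ∈-fibres-but-last c (λ c≡last → a≢c (toℕ-injective (trans (sym a≡last) c≡last))) b ,
    Resolves-sym (resolves-by Dist-refl (Dist-⊠ (Dist-K≢ (λ c≡a → a≢c (sym c≡a))) Dist-refl) z<s)

  K⊠H-generator : ∀ {k} (H : Graph (Fin n)) → 2 ≤ k → (∀ {x y} → Adj H x y → Adj H y x) →
                  SelfResolved k H → IsMetricGenerator (K (suc (suc m)) ⊠ H) fibres-but-last
  K⊠H-generator H 2≤k Adj-sym SR (a , b) (c , d) x≢y with b ≟ᶠ d
  ... | yes refl = resolves-in-fibre b (λ a≡c → x≢y (cong (_, b) a≡c))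
  ... | no  b≢d with SR b d b≢d
  ...   | w , inj₁ (_ , (d→w , k≤D) , b∈I) = (zero , w) , ∈-fibres-but-last zero (λ ()) w ,
    resolves-via-interval Adj-sym (≤-trans 2≤k k≤D) d→w b∈I b≢d zero a c
  ...   | w , inj₂ (_ , (b→w , k≤D) , d∈I) = (zero , w) , ∈-fibres-but-last zero (λ ()) w ,
    Resolves-sym (resolves-via-interval Adj-sym (≤-trans 2≤k k≤D) b→w d∈I (λ d≡b → b≢d (sym d≡b)) zero c a)

n/2+n/2≤n : ∀ n → n / 2 + n / 2 ≤ n
n/2+n/2≤n n = subst (_≤ n) (trans (*-suc (n / 2) 1) (cong (n / 2 +_) (*-identityʳ (n / 2)))) (m/n*n≤m n 2)

corollary1 : (n₁ : ℕ) → 2 ≤ n₁ →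
    ((n₂ : ℕ) → 4 ≤ n₂ → n₁ ∸ 1 < n₂ / 2 → DimLe (P n₁ ⊠ C n₂) n₂)
    × ((k : ℕ) → 2 ≤ k → (n₂ : ℕ) → (H : Graph (Fin n₂)) →
         IsSimple H → Connected H → SelfResolved k H →
         DimLe (K n₁ ⊠ H) ((n₁ ∸ 1) * n₂))
corollary1 (suc zero) (s≤s ())
corollary1 (suc (suc m)) _ = strong-product-with-cycle , strong-product-with-complete
  where
  strong-product-with-cycle : (n₂ : ℕ) → 4 ≤ n₂ → suc m < n₂ / 2 → DimLe (P (suc (suc m)) ⊠ C n₂) n₂
  strong-product-with-cycle n₂ _ 1+m<n₂/2 =
    column₀ (suc m) n₂ , ≤-reflexive (length-column₀ (suc m) n₂) ,
    P⊠C-generator (suc m) n₂ (≤-trans (+-mono-≤ 1+m<n₂/2 1+m<n₂/2) (n/2+n/2≤n n₂))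

  strong-product-with-complete : (k : ℕ) → 2 ≤ k → (n₂ : ℕ) → (H : Graph (Fin n₂)) →
    IsSimple H → Connected H → SelfResolved k H → DimLe (K (suc (suc m)) ⊠ H) (suc m * n₂)
  strong-product-with-complete k 2≤k n₂ H (Adj-sym , _) _ SR =
    fibres-but-last m n₂ , ≤-reflexive (length-fibres-but-last m n₂) , K⊠H-generator m n₂ H 2≤k (λ {x} {y} → Adj-sym x y) SR
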